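{- Let $G$ be a connected simple graph on at least two vertices with $\chi''_a(G)\leq\Delta(G)+3$, and let $H$ be the complete graph on $\Delta(G)+3$ vertices. Then $\chi''_a(G\circ H)\leq\Delta(G\circ H)+3$.
   Context: All graphs are finite and simple; $\Delta(\cdot)$ denotes maximum degree and $[k]=\{1,\ldots,k\}$. A proper total $k$-coloring of $G=(V,E)$ is a map $f:V\cup E\to[k]$ such that adjacent vertices get different colors, adjacent edges get different colors, and each edge gets a color different from the colors of its endvertices. The color set of $v$ is $C_f(v)=\{f(v)\}\cup\{f(vu): vu\in E\}$. An adjacent vertex distinguishing (avd) total $k$-coloring is a proper total $k$-coloring with $C_f(u)\neq C_f(v)$ for every edge $uv$; $\chi''_a(G)$ is the least such $k$. The corona $G\circ H$ is obtained from one copy of $G$ and $|V(G)|$ disjoint copies of $H$, one for each vertex $v$ of $G$, by joining each vertex $v$ of $G$ to every vertex of its copy of $H$. -}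

module Defs where

open import Data.Nat using (ℕ; zero; suc; _+_; _*_; _≤_; _⊔_)
open import Data.Fin using (Fin; splitAt; remQuot; _≟_)
open import Data.Bool using (Bool; true; false; T; not; _∧_; if_then_else_)
open import Data.Bool.Properties using (∧-comm)
open import Data.List using (List; allFin; map; foldr)
open import Data.Nat.ListAction using (sum)
open import Data.Sum using (_⊎_; inj₁; inj₂)
open import Data.Product using (_×_; _,_; Σ; ∃)
open import Relation.Nullary using (¬_; yes; no)
open import Relation.Nullary.Decidable using (⌊_⌋)
open import Relation.Binary.PropositionalEquality using (_≡_; _≢_; refl; sym; cong₂)
import Relation.Binary.PropositionalEquality
open import Function.Bundles using (_⇔_)

record Graph (n : ℕ) : Set where
  field
    adj     : Fin n → Fin n → Bool
    adj-sym : ∀ u v → adj u v ≡ adj v u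
    adj-irr : ∀ u → adj u u ≡ false
open Graph public

Adj : ∀ {n} → Graph n → Fin n → Fin n → Set
Adj G u v = T (adj G u v)

deg : ∀ {n} → Graph n → Fin n → ℕ
deg {n} G v = sum (map (λ u → if adj G v u then 1 else 0) (allFin n))

Δ : ∀ {n} → Graph n → ℕ
Δ {n} G = foldr _⊔_ 0 (map (deg G) (allFin n))

data Walk {n} (G : Graph n) : Fin n → Fin n → Set where
  here : ∀ {u} → Walk G u u
  step : ∀ {u v w} → Adj G u v → Walk G v w → Walk G u w

Connected : ∀ {n} → Graph n → Set
Connected {n} G = ∀ (u v : Fin n) → Walk G u v

eqb : ∀ {m} → Fin m → Fin m → Bool
eqb i j = ⌊ i ≟ j ⌋

eqb-sym : ∀ {m} (i j : Fin m) → eqb i j ≡ eqb j i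
eqb-sym i j with i ≟ j | j ≟ i
... | yes _ | yes _ = refl
... | no _  | no _  = refl
... | yes p | no q  = Data.Empty.⊥-elim (q (sym p)) where import Data.Empty
... | no q  | yes p = Data.Empty.⊥-elim (q (sym p)) where import Data.Empty

eqb-refl : ∀ {m} (i : Fin m) → eqb i i ≡ true
eqb-refl i with i ≟ i
... | yes _ = refl
... | no q = Data.Empty.⊥-elim (q refl) where import Data.Empty

K : (m : ℕ) → Graph m
K m = record
  { adj = λ a b → not (eqb a b)
  ; adj-sym = λ a b → Relation.Binary.PropositionalEquality.cong not (eqb-sym a b)
  ; adj-irr = λ a → Relation.Binary.PropositionalEquality.cong not (eqb-refl a)
  }

-- Corona G ∘ H: vertex set Fin (n + n * m), where the first n vertices are
-- the copy of G and vertex (i , a) ∈ Fin n × Fin m (encoded via remQuot)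
-- is vertex a of the copy of H attached to vertex i of G.
CVert : ℕ → ℕ → Set
CVert n m = Fin n ⊎ (Fin n × Fin m)

decode : ∀ {n m} → Fin (n + n * m) → CVert n m
decode {n} {m} x with splitAt n x
... | inj₁ i = inj₁ i
... | inj₂ y = inj₂ (remQuot m y)

cadj : ∀ {n m} → Graph n → Graph m → CVert n m → CVert n m → Bool
cadj G H (inj₁ i) (inj₁ j) = adj G i j
cadj G H (inj₁ i) (inj₂ (j , a)) = eqb i j
cadj G H (inj₂ (j , a)) (inj₁ i) = eqb j i
cadj G H (inj₂ (i , a)) (inj₂ (j , b)) = eqb i j ∧ adj H a b

cadj-sym : ∀ {n m} (G : Graph n) (H : Graph m) x y → cadj G H x y ≡ cadj G H y x
cadj-sym G H (inj₁ i) (inj₁ j) = adj-sym G i j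
cadj-sym G H (inj₁ i) (inj₂ (j , a)) = eqb-sym i j
cadj-sym G H (inj₂ (j , a)) (inj₁ i) = eqb-sym j i
cadj-sym G H (inj₂ (i , a)) (inj₂ (j , b)) = cong₂ _∧_ (eqb-sym i j) (adj-sym H a b)

cadj-irr : ∀ {n m} (G : Graph n) (H : Graph m) x → cadj G H x x ≡ false
cadj-irr G H (inj₁ i) = adj-irr G i
cadj-irr G H (inj₂ (i , a)) rewrite eqb-refl i = adj-irr H a

corona : ∀ {n m} → Graph n → Graph m → Graph (n + n * m)
corona G H = record
  { adj = λ x y → cadj G H (decode x) (decode y)
  ; adj-sym = λ x y → cadj-sym G H (decode x) (decode y)
  ; adj-irr = λ x → cadj-irr G H (decode x)
  }

-- Total colorings with k colors; the color set [k] = {1,…,k} is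
-- represented by Fin k.  Edge colors are given by a function on ordered
-- pairs that is required to be symmetric on edges.
record TotalColoring {n} (G : Graph n) (k : ℕ) : Set where
  field
    vcol : Fin n → Fin k
    ecol : Fin n → Fin n → Fin k
    ecol-sym   : ∀ u v → Adj G u v → ecol u v ≡ ecol v u
    vv-proper  : ∀ u v → Adj G u v → vcol u ≢ vcol v
    ee-proper  : ∀ u v w → Adj G u v → Adj G u w → v ≢ w → ecol u v ≢ ecol u w
    ve-proper  : ∀ u v → Adj G u v → ecol u v ≢ vcol u
open TotalColoring public

_∈C[_]_ : ∀ {n k} {G : Graph n} → Fin k → TotalColoring G k → Fin n → Set
_∈C[_]_ {G = G} c f v = (c ≡ vcol f v) ⊎ ∃ (λ u → Adj G v u × ecol f v u ≡ c)

record AVDTotalColoring {n} (G : Graph n) (k : ℕ) : Set where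
  field
    coloring : TotalColoring G k
    distinguishing : ∀ u v → Adj G u v →
      ¬ (∀ (c : Fin k) → (c ∈C[ coloring ] u) ⇔ (c ∈C[ coloring ] v))
open AVDTotalColoring public

-- χ''_a(G) ≤ b : the least k admitting an avd total k-coloring is ≤ b,
-- i.e. some k ≤ b admits an avd total k-coloring.
χ''a≤ : ∀ {n} → Graph n → ℕ → Set
χ''a≤ G b = Σ ℕ (λ k → k ≤ b × AVDTotalColoring G k)

-- Let m = Δ(G) + 3 and colour G ∘ K_m with the 2m colours 0, …, 2m − 1.  Keep the given
-- colouring of G (its at most m colours are taken among 0, …, m − 1), give the edge from a
-- vertex of G to vertex a of its copy of K_m the colour m + a, the edge ab inside a copy the
-- colour (a + b) mod m, and vertex a of a copy the colour m + (a + 1 mod m).  A vertex of G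
-- then sees every colour m + z, whereas vertex a of a copy sees only m + a and m + (a + 1),
-- which separates the two because m ≥ 3; two copy vertices a ≠ b see {a, a + 1} and
-- {b, b + 1}, which coincide only if a ≡ b + 1 and b ≡ a + 1, i.e. 2 ≡ 0 (mod m).  Finally
-- a vertex of G has degree at least Δ(G) + m in the corona, so 2m ≤ Δ(G ∘ K_m) + 3.

module Submission where

open import Defs
open import Data.Nat using (ℕ; zero; suc; _+_; _*_; _∸_; _≤_; _<_; _⊔_; z≤n; s≤s; NonZero; >-nonZero; _%_; _/_)
open import Data.Nat.Properties
open import Data.Nat.DivMod using (m≡m%n+[m/n]*n; m%n<n; m%n%n≡m%n; m<n⇒m%n≡m; %-distribˡ-+)
open import Data.Nat.Divisibility using (_∣_; divides; >⇒∤)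
open import Data.Nat.ListAction using (sum)
open import Data.Fin as Fin using (Fin; toℕ; fromℕ<; _↑ˡ_; _↑ʳ_; splitAt; join; combine; inject≤)
open import Data.Fin.Properties
  using (toℕ-fromℕ<; toℕ-injective; toℕ<n; splitAt-↑ˡ; splitAt-↑ʳ; join-splitAt; remQuot-combine; combine-remQuot;
         ↑ˡ-injective; ↑ʳ-injective; inject≤-injective)
open import Data.Bool using (Bool; T; if_then_else_)
open import Data.Bool.Properties using (T-∧)
open import Data.List using (map; tabulate; allFin)
open import Data.List.Properties using (map-tabulate; tabulate-cong; foldr-preservesᵇ; foldr-forcesᵇ)
open import Data.List.Relation.Unary.All as All using ()
open import Data.List.Relation.Unary.All.Properties using (map⁺; tabulate⁺)
open import Data.List.Membership.Propositional.Properties using (∈-map⁺; ∈-allFin)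
open import Data.Sum using (_⊎_; inj₁; inj₂; [_,_]′)
open import Data.Product using (_×_; _,_; proj₁; proj₂; ∃)
open import Relation.Nullary using (¬_; yes; no; contradiction)
open import Relation.Nullary.Decidable using (toWitness; toWitnessFalse; fromWitness)
open import Function.Bundles using (_⇔_; mk⇔; Equivalence)
open import Function.Properties.Equivalence using () renaming (trans to ⇔-trans; sym to ⇔-sym)
open import Relation.Binary.PropositionalEquality

x%n≡y%n⇒n∣y∸x : ∀ x y n .{{_ : NonZero n}} → x % n ≡ y % n → n ∣ y ∸ x
x%n≡y%n⇒n∣y∸x x y n eq = divides (y / n ∸ x / n) (begin
  y ∸ x                                     ≡⟨ cong₂ _∸_ (m≡m%n+[m/n]*n y n) (m≡m%n+[m/n]*n x n) ⟩
  (y % n + y / n * n) ∸ (x % n + x / n * n) ≡⟨ cong (λ r → (y % n + y / n * n) ∸ (r + x / n * n)) eq ⟩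
  (y % n + y / n * n) ∸ (y % n + x / n * n) ≡⟨ [m+n]∸[m+o]≡n∸o (y % n) _ _ ⟩
  y / n * n ∸ x / n * n                     ≡⟨ *-distribʳ-∸ n (y / n) (x / n) ⟨
  (y / n ∸ x / n) * n                       ∎)
  where open ≡-Reasoning

∣∧<⇒≡0 : ∀ {n d} → n ∣ d → d < n → d ≡ 0
∣∧<⇒≡0 {d = zero}  _   _   = refl
∣∧<⇒≡0 {d = suc _} n∣d d<n = contradiction n∣d (>⇒∤ d<n)

+-cancelˡ-% : ∀ k {x y n} .{{_ : NonZero n}} → x < n → y < n → (k + x) % n ≡ (k + y) % n → x ≡ y
+-cancelˡ-% k {x} {y} {n} x<n y<n eq =
  [ (λ x≤y → ordered x≤y y<n eq) , (λ y≤x → sym (ordered y≤x x<n (sym eq))) ]′ (≤-total x y)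
  where
  ordered : ∀ {u v} → u ≤ v → v < n → (k + u) % n ≡ (k + v) % n → u ≡ v
  ordered {u} {v} u≤v v<n eq′ = ≤-antisym u≤v (m∸n≡0⇒m≤n (∣∧<⇒≡0 n∣v∸u (≤-<-trans (m∸n≤m v u) v<n)))
    where
    n∣v∸u : n ∣ v ∸ u
    n∣v∸u = subst (n ∣_) ([m+n]∸[m+o]≡n∸o k v u) (x%n≡y%n⇒n∣y∸x (k + u) (k + v) n eq′)

module Rotation (m : ℕ) .{{_ : NonZero m}} where

  rot : ℕ → Fin m → Fin m
  rot k a = fromℕ< (m%n<n (k + toℕ a) m)

  toℕ-rot : ∀ k a → toℕ (rot k a) ≡ (k + toℕ a) % m
  toℕ-rot k a = toℕ-fromℕ< (m%n<n (k + toℕ a) m)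

  rot-injective : ∀ k {a b} → rot k a ≡ rot k b → a ≡ b
  rot-injective k {a} {b} eq = toℕ-injective (+-cancelˡ-% k (toℕ<n a) (toℕ<n b) (begin
    (k + toℕ a) % m ≡⟨ toℕ-rot k a ⟨
    toℕ (rot k a)   ≡⟨ cong toℕ eq ⟩
    toℕ (rot k b)   ≡⟨ toℕ-rot k b ⟩
    (k + toℕ b) % m ∎))
    where open ≡-Reasoning

  rot-rot : ∀ j k a → rot j (rot k a) ≡ rot (j + k) a
  rot-rot j k a = toℕ-injective (begin
    toℕ (rot j (rot k a))               ≡⟨ toℕ-rot j (rot k a) ⟩
    (j + toℕ (rot k a)) % m             ≡⟨ cong (λ r → (j + r) % m) (toℕ-rot k a) ⟩
    (j + (k + toℕ a) % m) % m           ≡⟨ %-distribˡ-+ j _ m ⟩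
    (j % m + (k + toℕ a) % m % m) % m   ≡⟨ cong (λ r → (j % m + r) % m) (m%n%n≡m%n (k + toℕ a) m) ⟩
    (j % m + (k + toℕ a) % m) % m       ≡⟨ %-distribˡ-+ j (k + toℕ a) m ⟨
    (j + (k + toℕ a)) % m               ≡⟨ cong (_% m) (+-assoc j k (toℕ a)) ⟨
    (j + k + toℕ a) % m                 ≡⟨ toℕ-rot (j + k) a ⟨
    toℕ (rot (j + k) a)                 ∎)
    where open ≡-Reasoning

  rot-fixedPointFree : ∀ {k} a → 0 < k → k < m → rot k a ≢ a
  rot-fixedPointFree {k} a 0<k k<m eq = <⇒≢ 0<k (sym (+-cancelˡ-% (toℕ a) k<m (≤-<-trans z≤n k<m) (begin
    (toℕ a + k) % m ≡⟨ cong (_% m) (+-comm (toℕ a) k) ⟩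
    (k + toℕ a) % m ≡⟨ toℕ-rot k a ⟨
    toℕ (rot k a)   ≡⟨ cong toℕ eq ⟩
    toℕ a           ≡⟨ m<n⇒m%n≡m (toℕ<n a) ⟨
    toℕ a % m       ≡⟨ cong (_% m) (+-identityʳ (toℕ a)) ⟨
    (toℕ a + 0) % m ∎)))
    where open ≡-Reasoning

fresh₂ : ∀ {m} → 3 ≤ m → (x y : Fin m) → ∃ λ z → z ≢ x × z ≢ y
fresh₂ (s≤s (s≤s (s≤s _))) Fin.zero                 Fin.zero                 = Fin.suc Fin.zero , (λ ()) , (λ ())
fresh₂ (s≤s (s≤s (s≤s _))) Fin.zero                 (Fin.suc Fin.zero)       = Fin.suc (Fin.suc Fin.zero) , (λ ()) , (λ ())
fresh₂ (s≤s (s≤s (s≤s _))) Fin.zero                 (Fin.suc (Fin.suc _))    = Fin.suc Fin.zero , (λ ()) , (λ ())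
fresh₂ (s≤s (s≤s (s≤s _))) (Fin.suc Fin.zero)       Fin.zero                 = Fin.suc (Fin.suc Fin.zero) , (λ ()) , (λ ())
fresh₂ (s≤s (s≤s (s≤s _))) (Fin.suc (Fin.suc _))    Fin.zero                 = Fin.suc Fin.zero , (λ ()) , (λ ())
fresh₂ (s≤s (s≤s (s≤s _))) (Fin.suc _)              (Fin.suc _)              = Fin.zero , (λ ()) , (λ ())

↑ˡ≢↑ʳ : ∀ {a b} (i : Fin a) (j : Fin b) → i ↑ˡ b ≢ a ↑ʳ j
↑ˡ≢↑ʳ {a} {b} i j eq with trans (sym (splitAt-↑ˡ a i b)) (trans (cong (splitAt a) eq) (splitAt-↑ʳ a b j))
... | ()

∑ : ∀ {n} → (Fin n → ℕ) → ℕ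
∑ f = sum (tabulate f)

∑-cong : ∀ {n} {f g : Fin n → ℕ} → (∀ i → f i ≡ g i) → ∑ f ≡ ∑ g
∑-cong f≗g = cong sum (tabulate-cong f≗g)

∑-const : ∀ n c → ∑ {n} (λ _ → c) ≡ n * c
∑-const zero    c = refl
∑-const (suc n) c = cong (c +_) (∑-const n c)

∑-↑ : ∀ a {b} (f : Fin (a + b) → ℕ) → ∑ f ≡ ∑ (λ i → f (i ↑ˡ b)) + ∑ (λ j → f (a ↑ʳ j))
∑-↑ zero    f = refl
∑-↑ (suc a) f = trans (cong (f Fin.zero +_) (∑-↑ a (λ i → f (Fin.suc i)))) (sym (+-assoc (f Fin.zero) _ _))

∑-combine : ∀ a {b} (f : Fin (a * b) → ℕ) → ∑ f ≡ ∑ (λ i → ∑ (λ j → f (combine {a} {b} i j)))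
∑-combine zero        f = refl
∑-combine (suc a) {b} f = trans (∑-↑ b f) (cong (∑ (λ j → f (j ↑ˡ (a * b))) +_) (∑-combine a (λ y → f (b ↑ʳ y))))

term≤∑ : ∀ {n} (f : Fin n → ℕ) i → f i ≤ ∑ f
term≤∑ f Fin.zero    = m≤m+n _ _
term≤∑ f (Fin.suc i) = ≤-trans (term≤∑ (λ j → f (Fin.suc j)) i) (m≤n+m _ _)

indicator : Bool → ℕ
indicator b = if b then 1 else 0

deg≡∑ : ∀ {n} (G : Graph n) v → deg G v ≡ ∑ (λ u → indicator (adj G v u))
deg≡∑ G v = cong sum (map-tabulate (λ u → u) (λ u → indicator (adj G v u)))

deg≤Δ : ∀ {n} (G : Graph n) v → deg G v ≤ Δ G
deg≤Δ {n} G v = All.lookup (foldr-forcesᵇ ⊔-bounded 0 (map (deg G) (allFin n)) ≤-refl) (∈-map⁺ (deg G) (∈-allFin v))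
  where
  ⊔-bounded : ∀ x y → x ⊔ y ≤ Δ G → x ≤ Δ G × y ≤ Δ G
  ⊔-bounded x y le = m⊔n≤o⇒m≤o x y le , m⊔n≤o⇒n≤o x y le

Δ-lub-+ : ∀ {n} (G : Graph n) {c B} → Fin n → (∀ v → deg G v + c ≤ B) → Δ G + c ≤ B
Δ-lub-+ G {c} {B} v₀ bound =
  foldr-preservesᵇ {P = λ d → d + c ≤ B} ⊔-closed (≤-trans (m≤n+m c (deg G v₀)) (bound v₀)) (map⁺ (tabulate⁺ bound))
  where
  ⊔-closed : ∀ {x y} → x + c ≤ B → y + c ≤ B → x ⊔ y + c ≤ B
  ⊔-closed {x} {y} p q = subst (_≤ B) (sym (+-distribʳ-⊔ c x y)) (⊔-lub p q)

T-eqb⇒≡ : ∀ {n} {i j : Fin n} → T (eqb i j) → i ≡ j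
T-eqb⇒≡ {i = i} {j} = toWitness {a? = i Fin.≟ j}

module _ {n m : ℕ} where

  encode : CVert n m → Fin (n + n * m)
  encode (inj₁ i)       = i ↑ˡ (n * m)
  encode (inj₂ (i , a)) = n ↑ʳ combine i a

  decode-encode : ∀ p → decode (encode p) ≡ p
  decode-encode (inj₁ i) rewrite splitAt-↑ˡ n i (n * m) = refl
  decode-encode (inj₂ (i , a)) rewrite splitAt-↑ʳ n (n * m) (combine i a) = cong inj₂ (remQuot-combine i a)

  encode-decode : ∀ x → encode (decode x) ≡ x
  encode-decode x with splitAt n x in eq
  ... | inj₁ i = trans (cong (join n (n * m)) (sym eq)) (join-splitAt n (n * m) x)
  ... | inj₂ y = trans (cong (n ↑ʳ_) (combine-remQuot {n} m y))
                       (trans (cong (join n (n * m)) (sym eq)) (join-splitAt n (n * m) x))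

  decode-injective : ∀ {x y} → decode x ≡ decode y → x ≡ y
  decode-injective {x} {y} eq = trans (sym (encode-decode x)) (trans (cong encode eq) (encode-decode y))

deg-corona-root : ∀ {n m} (G : Graph n) (H : Graph m) i → deg G i + m ≤ deg (corona G H) (encode {n} {m} (inj₁ i))
deg-corona-root {n} {m} G H i = begin
  deg G i + m
    ≡⟨ cong₂ _+_ (deg≡∑ G i) copy-count ⟩
  ∑ (λ j → edge (inj₁ j)) + ∑ (λ a → edge (inj₂ (i , a)))
    ≤⟨ +-monoʳ-≤ _ (term≤∑ (λ j → ∑ (λ a → edge (inj₂ (j , a)))) i) ⟩
  ∑ (λ j → edge (inj₁ j)) + ∑ (λ j → ∑ (λ a → edge (inj₂ (j , a))))
    ≡⟨ cong₂ _+_ (∑-cong (λ j → cong edge (sym (decode-encode (inj₁ j)))))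
                 (trans (∑-cong λ j → ∑-cong λ a → cong edge (sym (decode-encode (inj₂ (j , a))))) (sym (∑-combine n _))) ⟩
  ∑ (λ x → edge (decode (x ↑ˡ (n * m)))) + ∑ (λ y → edge (decode (n ↑ʳ y)))
    ≡⟨ ∑-↑ n _ ⟨
  ∑ (λ x → edge (decode x))
    ≡⟨ ∑-cong (λ x → cong (λ p → indicator (cadj G H p (decode x))) (sym (decode-encode (inj₁ i)))) ⟩
  ∑ (λ x → indicator (adj (corona G H) (encode (inj₁ i)) x))
    ≡⟨ deg≡∑ (corona G H) _ ⟨
  deg (corona G H) (encode (inj₁ i))
    ∎
  where
  open ≤-Reasoning
  edge : CVert n m → ℕ
  edge q = indicator (cadj G H (inj₁ i) q)
  copy-count : m ≡ ∑ (λ a → edge (inj₂ (i , a)))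
  copy-count = trans (sym (trans (∑-const m 1) (*-identityʳ m))) (∑-cong {m} (λ _ → cong indicator (sym (eqb-refl i))))

Δ-corona : ∀ {n m} (G : Graph n) (H : Graph m) → Fin n → Δ G + m ≤ Δ (corona G H)
Δ-corona G H v₀ = Δ-lub-+ G v₀ (λ i → ≤-trans (deg-corona-root G H i) (deg≤Δ (corona G H) _))

module CoronaColouring {n k m} (G : Graph n) (f : AVDTotalColoring G k) (k≤m : k ≤ m) (3≤m : 3 ≤ m) where

  private instance
    m-nonZero : NonZero m
    m-nonZero = >-nonZero (≤-trans (s≤s z≤n) 3≤m)

  open Rotation m

  φ : TotalColoring G k
  φ = coloring f

  σ : Fin m → Fin m
  σ = rot 1

  _⊕_ : Fin m → Fin m → Fin m
  a ⊕ b = rot (toℕ a) b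

  ⊕-comm : ∀ a b → a ⊕ b ≡ b ⊕ a
  ⊕-comm a b = toℕ-injective (trans (toℕ-rot (toℕ a) b) (trans (cong (_% m) (+-comm (toℕ a) (toℕ b))) (sym (toℕ-rot (toℕ b) a))))

  σ-fixedPointFree : ∀ a → σ a ≢ a
  σ-fixedPointFree a = rot-fixedPointFree a (s≤s z≤n) (≤-trans (s≤s (s≤s z≤n)) 3≤m)

  σσ-fixedPointFree : ∀ a → σ (σ a) ≢ a
  σσ-fixedPointFree a eq = rot-fixedPointFree a (s≤s z≤n) 3≤m (trans (sym (rot-rot 1 1 a)) eq)

  lo hi : Fin m → Fin (m + m)
  lo c = c ↑ˡ m
  hi a = m ↑ʳ a

  old : Fin k → Fin (m + m)
  old c = lo (inject≤ c k≤m)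

  old-injective : ∀ {c d} → old c ≡ old d → c ≡ d
  old-injective eq = inject≤-injective k≤m k≤m _ _ (↑ˡ-injective m _ _ eq)

  hi-injective : ∀ {a b} → hi a ≡ hi b → a ≡ b
  hi-injective = ↑ʳ-injective m _ _

  _~_ : CVert n m → CVert n m → Set
  p ~ q = T (cadj G (K m) p q)

  vc : CVert n m → Fin (m + m)
  vc (inj₁ i)       = old (vcol φ i)
  vc (inj₂ (_ , a)) = hi (σ a)

  ec : CVert n m → CVert n m → Fin (m + m)
  ec (inj₁ i)       (inj₁ j)       = old (ecol φ i j)
  ec (inj₁ _)       (inj₂ (_ , a)) = hi a
  ec (inj₂ (_ , a)) (inj₁ _)       = hi a
  ec (inj₂ (_ , a)) (inj₂ (_ , b)) = lo (a ⊕ b)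

  copy~copy : ∀ {i j a b} → inj₂ (i , a) ~ inj₂ (j , b) → i ≡ j × a ≢ b
  copy~copy {i} {j} {a} {b} t with Equivalence.to T-∧ t
  ... | i≡j , a≢b = T-eqb⇒≡ i≡j , toWitnessFalse {a? = a Fin.≟ b} a≢b

  ec-sym : ∀ p q → p ~ q → ec p q ≡ ec q p
  ec-sym (inj₁ i)       (inj₁ j)       t = cong old (ecol-sym φ i j t)
  ec-sym (inj₁ _)       (inj₂ _)       _ = refl
  ec-sym (inj₂ _)       (inj₁ _)       _ = refl
  ec-sym (inj₂ (_ , a)) (inj₂ (_ , b)) _ = cong lo (⊕-comm a b)

  vv-proper′ : ∀ p q → p ~ q → vc p ≢ vc q
  vv-proper′ (inj₁ i)       (inj₁ j)       t eq = vv-proper φ i j t (old-injective eq)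
  vv-proper′ (inj₁ _)       (inj₂ _)       _ eq = ↑ˡ≢↑ʳ _ _ eq
  vv-proper′ (inj₂ _)       (inj₁ _)       _ eq = ↑ˡ≢↑ʳ _ _ (sym eq)
  vv-proper′ (inj₂ (_ , a)) (inj₂ (_ , b)) t eq = proj₂ (copy~copy t) (rot-injective 1 (hi-injective eq))

  ve-proper′ : ∀ p q → p ~ q → ec p q ≢ vc p
  ve-proper′ (inj₁ i)       (inj₁ j) t eq = ve-proper φ i j t (old-injective eq)
  ve-proper′ (inj₁ _)       (inj₂ _) _ eq = ↑ˡ≢↑ʳ _ _ (sym eq)
  ve-proper′ (inj₂ (_ , a)) (inj₁ _) _ eq = σ-fixedPointFree a (sym (hi-injective eq))
  ve-proper′ (inj₂ _)       (inj₂ _) _ eq = ↑ˡ≢↑ʳ _ _ eq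

  ee-proper′ : ∀ p q s → p ~ q → p ~ s → q ≢ s → ec p q ≢ ec p s
  ee-proper′ (inj₁ i) (inj₁ j) (inj₁ l) t u j≢l eq =
    ee-proper φ i j l t u (λ j≡l → j≢l (cong inj₁ j≡l)) (old-injective eq)
  ee-proper′ (inj₁ _) (inj₁ _) (inj₂ _) _ _ _ eq = ↑ˡ≢↑ʳ _ _ eq
  ee-proper′ (inj₁ _) (inj₂ _) (inj₁ _) _ _ _ eq = ↑ˡ≢↑ʳ _ _ (sym eq)
  ee-proper′ (inj₁ _) (inj₂ (j , a)) (inj₂ (l , b)) t u q≢s eq =
    q≢s (cong₂ (λ x y → inj₂ (x , y)) (trans (sym (T-eqb⇒≡ t)) (T-eqb⇒≡ u)) (hi-injective eq))
  ee-proper′ (inj₂ _) (inj₁ j) (inj₁ l) t u q≢s _ = q≢s (cong inj₁ (trans (sym (T-eqb⇒≡ t)) (T-eqb⇒≡ u)))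
  ee-proper′ (inj₂ _) (inj₁ _) (inj₂ _) _ _ _ eq = ↑ˡ≢↑ʳ _ _ (sym eq)
  ee-proper′ (inj₂ _) (inj₂ _) (inj₁ _) _ _ _ eq = ↑ˡ≢↑ʳ _ _ eq
  ee-proper′ (inj₂ (i , a)) (inj₂ (j , b)) (inj₂ (l , c)) t u q≢s eq =
    q≢s (cong₂ (λ x y → inj₂ (x , y))
               (trans (sym (proj₁ (copy~copy {i} {j} {a} {b} t))) (proj₁ (copy~copy {i} {l} {a} {c} u)))
               (rot-injective (toℕ a) (↑ˡ-injective m _ _ eq)))

  _∈ᶜ_ : Fin (m + m) → CVert n m → Set
  c ∈ᶜ p = (c ≡ vc p) ⊎ ∃ (λ q → p ~ q × ec p q ≡ c)

  old-∈ᶜ-root : ∀ {c i} → c ∈C[ φ ] i ⇔ old c ∈ᶜ inj₁ i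
  old-∈ᶜ-root {c} {i} = mk⇔ to from
    where
    to : c ∈C[ φ ] i → old c ∈ᶜ inj₁ i
    to (inj₁ eq)           = inj₁ (cong old eq)
    to (inj₂ (u , t , eq)) = inj₂ (inj₁ u , t , cong old eq)
    from : old c ∈ᶜ inj₁ i → c ∈C[ φ ] i
    from (inj₁ eq)                  = inj₁ (old-injective eq)
    from (inj₂ (inj₁ u , t , eq))   = inj₂ (u , t , old-injective eq)
    from (inj₂ (inj₂ _ , _ , eq))   = contradiction (sym eq) (↑ˡ≢↑ʳ _ _)

  hi-∈ᶜ-root : ∀ i z → hi z ∈ᶜ inj₁ i
  hi-∈ᶜ-root i z = inj₂ (inj₂ (i , z) , fromWitness {a? = i Fin.≟ i} refl , refl)

  hi-∈ᶜ-copy : ∀ i a → hi a ∈ᶜ inj₂ (i , a)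
  hi-∈ᶜ-copy i a = inj₂ (inj₁ i , fromWitness {a? = i Fin.≟ i} refl , refl)

  hi-∉ᶜ-copy : ∀ {j a z} → z ≢ a → z ≢ σ a → ¬ (hi z ∈ᶜ inj₂ (j , a))
  hi-∉ᶜ-copy _   z≢σa (inj₁ eq)                = z≢σa (hi-injective eq)
  hi-∉ᶜ-copy z≢a _    (inj₂ (inj₁ _ , _ , eq)) = z≢a (sym (hi-injective eq))
  hi-∉ᶜ-copy _   _    (inj₂ (inj₂ _ , _ , eq)) = ↑ˡ≢↑ʳ _ _ eq

  separatedˡ : ∀ {c} p q → c ∈ᶜ p → ¬ (c ∈ᶜ q) → ¬ (∀ d → d ∈ᶜ p ⇔ d ∈ᶜ q)
  separatedˡ _ _ c∈p c∉q same = c∉q (Equivalence.to (same _) c∈p)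

  separatedʳ : ∀ {c} p q → c ∈ᶜ q → ¬ (c ∈ᶜ p) → ¬ (∀ d → d ∈ᶜ p ⇔ d ∈ᶜ q)
  separatedʳ _ _ c∈q c∉p same = c∉p (Equivalence.from (same _) c∈q)

  distinguishing′ : ∀ p q → p ~ q → ¬ (∀ c → c ∈ᶜ p ⇔ c ∈ᶜ q)
  distinguishing′ (inj₁ i) (inj₁ j) t same =
    distinguishing f i j t (λ c → ⇔-trans old-∈ᶜ-root (⇔-trans (same (old c)) (⇔-sym old-∈ᶜ-root)))
  distinguishing′ p@(inj₁ i) q@(inj₂ (_ , a)) _ with fresh₂ 3≤m a (σ a)
  ... | z , z≢a , z≢σa = separatedˡ p q (hi-∈ᶜ-root i z) (hi-∉ᶜ-copy z≢a z≢σa)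
  distinguishing′ p@(inj₂ (_ , a)) q@(inj₁ i) _ with fresh₂ 3≤m a (σ a)
  ... | z , z≢a , z≢σa = separatedʳ p q (hi-∈ᶜ-root i z) (hi-∉ᶜ-copy z≢a z≢σa)
  distinguishing′ p@(inj₂ (i , a)) q@(inj₂ (j , b)) t with proj₂ (copy~copy {i} {j} {a} {b} t) | a Fin.≟ σ b
  ... | a≢b | no a≢σb  = separatedˡ p q (hi-∈ᶜ-copy i a) (hi-∉ᶜ-copy a≢b a≢σb)
  ... | a≢b | yes a≡σb = separatedʳ p q (hi-∈ᶜ-copy j b) (hi-∉ᶜ-copy (λ b≡a → a≢b (sym b≡a))
                           (λ b≡σa → σσ-fixedPointFree b (trans (cong σ (sym a≡σb)) (sym b≡σa))))

  colouring : TotalColoring (corona G (K m)) (m + m)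
  colouring = record
    { vcol      = λ x → vc (decode x)
    ; ecol      = λ x y → ec (decode x) (decode y)
    ; ecol-sym  = λ x y → ec-sym (decode x) (decode y)
    ; vv-proper = λ x y → vv-proper′ (decode x) (decode y)
    ; ee-proper = λ x y z t u y≢z → ee-proper′ (decode x) (decode y) (decode z) t u (λ eq → y≢z (decode-injective eq))
    ; ve-proper = λ x y → ve-proper′ (decode x) (decode y)
    }

  ∈C⇔∈ᶜ : ∀ {c x} → c ∈C[ colouring ] x ⇔ c ∈ᶜ decode x
  ∈C⇔∈ᶜ {c} {x} = mk⇔ to from
    where
    to : c ∈C[ colouring ] x → c ∈ᶜ decode x
    to (inj₁ eq)           = inj₁ eq
    to (inj₂ (y , t , eq)) = inj₂ (decode y , t , eq)
    from : c ∈ᶜ decode x → c ∈C[ colouring ] x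
    from (inj₁ eq)           = inj₁ eq
    from (inj₂ (q , t , eq)) =
      inj₂ (encode q , subst (λ r → decode x ~ r × ec (decode x) r ≡ c) (sym (decode-encode q)) (t , eq))

  avd : AVDTotalColoring (corona G (K m)) (m + m)
  avd = record
    { coloring       = colouring
    ; distinguishing = λ x y t same →
        distinguishing′ (decode x) (decode y) t (λ c → ⇔-trans (⇔-sym ∈C⇔∈ᶜ) (⇔-trans (same c) ∈C⇔∈ᶜ))
    }

theorem4 : ∀ {n} (G : Graph n) → 2 ≤ n → Connected G → χ''a≤ G (Δ G + 3) →
    χ''a≤ (corona G (K (Δ G + 3))) (Δ (corona G (K (Δ G + 3))) + 3)
theorem4 {suc _} G _ _ (k , k≤m , f) = m + m , 2m≤Δ+3 , CoronaColouring.avd G f k≤m (m≤n+m 3 (Δ G))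
  where
  m : ℕ
  m = Δ G + 3
  2m≤Δ+3 : m + m ≤ Δ (corona G (K m)) + 3
  2m≤Δ+3 = begin
    Δ G + 3 + m     ≡⟨ +-assoc (Δ G) 3 m ⟩
    Δ G + (3 + m)   ≡⟨ cong (Δ G +_) (+-comm 3 m) ⟩
    Δ G + (m + 3)   ≡⟨ +-assoc (Δ G) m 3 ⟨
    Δ G + m + 3     ≤⟨ +-monoˡ-≤ 3 (Δ-corona G (K m) Fin.zero) ⟩
    Δ (corona G (K m)) + 3 ∎
    where open ≤-Reasoning
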